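{- If $G$ is a transitive permutation group of prime degree $n$, then $\rho(G)=1$. Consequently $\mathcal{I}_n=\{1\}$ for every prime $n$.
   Context: Let $G$ be a permutation group on a finite set $\Omega$. A subset $\mathcal{F}\subseteq G$ is intersecting if for all $g,h\in\mathcal{F}$ there is $\omega\in\Omega$ with $\omega^g=\omega^h$. Let $G_\omega$ be a point stabilizer of maximum cardinality. The intersection density of $G$ is $\rho(G)=\max\{|\mathcal{F}|/|G_\omega| : \mathcal{F}\subseteq G \text{ intersecting}\}$. For $n\ge 2$, $\mathcal{I}_n=\{\rho(G) : G \text{ transitive of degree } n\}$. -}

module Defs where

open import Data.Nat using (ℕ; zero; suc; _⊔_)
open import Data.Fin using (Fin; _≟_)
open import Data.Fin.Permutation using (Permutation′; _⟨$⟩ʳ_; _≈_; id; flip; _∘ₚ_)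
open import Data.List using (List; length; filter; map; foldr; allFin)
open import Data.List.Relation.Unary.Any using (Any)
open import Data.List.Relation.Unary.All using (All)
open import Data.List.Relation.Unary.AllPairs using (AllPairs)
open import Data.Integer using (+_)
open import Data.Rational using (ℚ; _/_; _≤_; 0ℚ)
open import Data.Product using (Σ; ∃; _×_)
open import Relation.Nullary using (¬_)
open import Relation.Binary.PropositionalEquality using (_≡_)

-- Permutations of Ω = Fin n are 'Permutation′ n'; two permutations are the same
-- group element iff they agree pointwise ('_≈_' from Data.Fin.Permutation).

_∈ₚ_ : ∀ {n} → Permutation′ n → List (Permutation′ n) → Set
g ∈ₚ L = Any (λ h → g ≈ h) L

Distinct : ∀ {n} → List (Permutation′ n) → Set
Distinct L = AllPairs (λ g h → ¬ (g ≈ h)) L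

record PermGroup (n : ℕ) : Set where
  field
    elems    : List (Permutation′ n)
    distinct : Distinct elems
    hasId    : id ∈ₚ elems
    closed∘  : ∀ g h → g ∈ₚ elems → h ∈ₚ elems → (g ∘ₚ h) ∈ₚ elems
    closed⁻¹ : ∀ g → g ∈ₚ elems → flip g ∈ₚ elems
open PermGroup public

Transitive : ∀ {n} → PermGroup n → Set
Transitive {n} G = ∀ (α β : Fin n) → Σ (Permutation′ n) λ g → g ∈ₚ elems G × (g ⟨$⟩ʳ α ≡ β)

IsIntersectingSubset : ∀ {n} → PermGroup n → List (Permutation′ n) → Set
IsIntersectingSubset {n} G F =
  Distinct F × All (λ g → g ∈ₚ elems G) F ×
  All (λ g → All (λ h → ∃ λ (ω : Fin n) → g ⟨$⟩ʳ ω ≡ h ⟨$⟩ʳ ω) F) F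

stabSize : ∀ {n} → PermGroup n → Fin n → ℕ
stabSize G ω = length (filter (λ g → (g ⟨$⟩ʳ ω) ≟ ω) (elems G))

maxStab : ∀ {n} → PermGroup n → ℕ
maxStab {n} G = foldr _⊔_ 0 (map (stabSize G) (allFin n))

-- a / b as a rational (b = 0 never occurs below, since |G_ω| ≥ 1 for n ≥ 1)
ratio : ℕ → ℕ → ℚ
ratio a zero    = 0ℚ
ratio a (suc b) = + a / suc b

IsIntersectionDensity : ∀ {n} → PermGroup n → ℚ → Set
IsIntersectionDensity {n} G r =
  (Σ (List (Permutation′ n)) λ F → IsIntersectingSubset G F × (r ≡ ratio (length F) (maxStab G)))
  × (∀ F → IsIntersectingSubset G F → ratio (length F) (maxStab G) ≤ r)

InI : ℕ → ℚ → Set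
InI n r = Σ (PermGroup n) λ G → Transitive G × IsIntersectionDensity G r

module Submission where

open import Defs
open import Data.Nat.Primality using (Prime)
open import Data.Nat using (ℕ)
open import Data.Rational using (ℚ; 1ℚ)
open import Data.Product using (_×_)
open import Relation.Binary.PropositionalEquality using (_≡_)

-- Let G be transitive of prime degree p. By orbit–stabilizer |G| = p·|G_ω|, so by Cauchy's
-- theorem (McKay's proof: the rotation of the p-tuples with product 1 has a number of fixed
-- points divisible by p) G contains an element c ≠ 1 with c^p = 1. On p points such a c is a
-- p-cycle, so for i ≠ j the powers c^i and c^j disagree at every point. Hence for an intersecting
-- F the p right translates F c^i are pairwise disjoint subsets of G, giving p·|F| ≤ |G| = p·|G_ω|.
-- Thus |F| ≤ |G_ω|, with equality for the stabilizer, and ρ(G) = 1. A transitive group of degree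
-- p exists (the cyclic shifts), so I_p = {1}.

open import Algebra.Properties.CommutativeSemigroup using (x∙yz≈y∙xz)
open import Data.Empty using (⊥-elim)
open import Data.Fin using (Fin; toℕ; zero; fromℕ<) renaming (_≟_ to _≟ᶠ_)
open import Data.Fin.Properties using (all?; ¬∀⟶∃¬; toℕ<n; toℕ-injective; toℕ-fromℕ<; ≡-decSetoid)
open import Data.Fin.Permutation
  using (Permutation′; _⟨$⟩ʳ_; _⟨$⟩ˡ_; id; flip; _∘ₚ_; inverseˡ; inverseʳ; permutation)
  renaming (_≈_ to _≈ₚ_)
import Data.Integer as ℤ
import Data.Integer.Properties as ℤ
open import Data.List
  using (List; []; _∷_; [_]; _++_; _∷ʳ_; length; filter; map; concatMap; foldr; replicate; applyUpTo; allFin)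
open import Data.List.Properties
  using (length-++; length-map; length-tabulate; length-replicate; length-applyUpTo; length-removeAt′;
         ++-assoc; ++-identityʳ; filter-all; filter-accept; filter-reject)
open import Data.List.Relation.Unary.Any as Any using (Any; here; there; index)
import Data.List.Relation.Unary.Any.Properties as Any
open import Data.List.Relation.Unary.All as All using (All; []; _∷_)
import Data.List.Relation.Unary.All.Properties as All
open import Data.List.Relation.Unary.All.Properties.Core using (¬All⇒Any¬)
open import Data.List.Relation.Unary.AllPairs using ([]; _∷_)
import Data.List.Relation.Unary.AllPairs as AllPairs
import Data.List.Relation.Unary.AllPairs.Properties as AllPairs
open import Data.List.Relation.Unary.Unique.Propositional.Properties using (allFin⁺)
import Data.List.Relation.Unary.Unique.Setoid as UniqueSetoid
open import Data.List.Relation.Binary.Pointwise as Pointwise using ([]; _∷_)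
import Data.List.Relation.Binary.Equality.Setoid as SetoidEquality
open import Data.List.Relation.Binary.Equality.DecSetoid using (≋-decSetoid)
import Data.List.Membership.Setoid as Membership
import Data.List.Membership.DecSetoid as DecMembership
open import Data.List.Membership.Setoid.Properties
  using (∈-resp-≈; ∉-resp-≈; ∉⇒All[≉]; ∈-filter⁺; ∈-map⁺; ∈-concatMap⁺; ∈-applyUpTo⁺; ∈-applyUpTo⁻;
         ∈-length)
open import Data.List.Membership.Propositional using () renaming (_∈_ to _∈ₗ_)
open import Data.List.Membership.Propositional.Properties using (∈-allFin)
open import Data.Nat using (zero; suc; _+_; _*_; _∸_; _^_; _≤_; _<_; _⊔_; _%_; _/_; z≤n; s≤s; NonZero)
open import Data.Nat.Base using (>-nonZero; >-nonZero⁻¹; nonTrivial⇒n>1)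
open import Data.Nat.Properties
  using (+-comm; +-assoc; +-suc; +-identityʳ; +-commutativeSemigroup; +-monoʳ-<; *-comm; *-cancelˡ-≡; *-cancelˡ-≤;
         ≤-trans; ≤-antisym; ≤-reflexive; <⇒≤; <-irrefl; <-cmp; n<1+n; m<n+m; m≤m+n; m<n⇒0<n∸m;
         m∸n+n≡m; m+[n∸m]≡n; suc-injective; ⊔-idem; ⊔-identityʳ; module ≤-Reasoning)
open import Data.Nat.DivMod
  using (_mod_; m≡m%n+[m/n]*n; m%n<n; %-distribˡ-+; m%n%n≡m%n; [m+n]%n≡m%n; m<n⇒m%n≡m; n%n≡0)
open import Data.Nat.Divisibility using (_∣_; divides; ∣m+n∣m⇒∣n; ∣m⇒∣m*n; n∣m*n; ∣⇒≤)
open import Data.Nat.Coprimality using (prime⇒coprime; coprime-Bézout)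
open import Data.Nat.GCD using (module Bézout)
open import Data.Nat.GeneralisedArithmetic using (fold; fold-+)
open import Data.Nat.Induction using (<-wellFounded)
open import Data.Nat.Primality using (prime⇒nonZero; prime⇒nonTrivial; ¬prime[0])
open import Data.Product using (∃; _,_; proj₁; proj₂)
open import Data.Rational using () renaming (_≤_ to _≤ℚ_)
open import Data.Rational.Properties
  using (fromℚᵘ-cong; toℚᵘ-cancel-≤; toℚᵘ-fromℚᵘ) renaming (≤-antisym to ≤ℚ-antisym)
import Data.Rational.Unnormalised as ℚᵘ
import Data.Rational.Unnormalised.Properties as ℚᵘ
open import Function using (_∘_)
open import Induction.WellFounded using (Acc; acc)
open import Level using (0ℓ)
open import Relation.Binary.Bundles using (Setoid; DecSetoid)
open import Relation.Binary.Definitions using (_Respects_; tri<; tri≈; tri>)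
import Relation.Binary.Reasoning.Setoid as SetoidReasoning
open import Relation.Binary.PropositionalEquality as ≡ using (_≢_; cong; subst)
open import Relation.Nullary using (¬_; yes; no)
open import Relation.Unary using (Pred; Decidable)
open import Relation.Unary.Properties using (∁?)

module _ {a p} {A : Set a} {P : Pred A p} (P? : Decidable P) where

  length-filter-∁ : ∀ xs → length (filter P? xs) + length (filter (∁? P?) xs) ≡ length xs
  length-filter-∁ []       = ≡.refl
  length-filter-∁ (x ∷ xs) with P? x
  ... | yes _ = cong suc (length-filter-∁ xs)
  ... | no  _ = ≡.trans (+-suc _ _) (cong suc (length-filter-∁ xs))

  filter-filter-⊆ : ∀ {q} {Q : Pred A q} (Q? : Decidable Q) → (∀ {x} → P x → Q x) →
                    ∀ xs → filter P? (filter Q? xs) ≡ filter P? xs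
  filter-filter-⊆ Q? P⊆Q []       = ≡.refl
  filter-filter-⊆ Q? P⊆Q (x ∷ xs) with P? x | Q? x
  ... | yes px | yes _  = ≡.trans (filter-accept P? px) (cong (x ∷_) (filter-filter-⊆ Q? P⊆Q xs))
  ... | yes px | no ¬qx = ⊥-elim (¬qx (P⊆Q px))
  ... | no ¬px | yes _  = ≡.trans (filter-reject P? ¬px) (filter-filter-⊆ Q? P⊆Q xs)
  ... | no _   | no _   = filter-filter-⊆ Q? P⊆Q xs

length-concatMap-const : ∀ {a b} {A : Set a} {B : Set b} (f : A → List B) {k} →
                         (∀ x → length (f x) ≡ k) → ∀ xs → length (concatMap f xs) ≡ length xs * k
length-concatMap-const f |f|≡k []       = ≡.refl
length-concatMap-const f |f|≡k (x ∷ xs) =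
  ≡.trans (length-++ (f x)) (≡.cong₂ _+_ (|f|≡k x) (length-concatMap-const f |f|≡k xs))

foldr-⊔-map-const : ∀ {a} {A : Set a} (f : A → ℕ) {c} → (∀ x → f x ≡ c) →
                    ∀ {x xs} → x ∈ₗ xs → foldr _⊔_ 0 (map f xs) ≡ c
foldr-⊔-map-const f f≡c {xs = y ∷ []}     _ = ≡.trans (⊔-identityʳ (f y)) (f≡c y)
foldr-⊔-map-const f f≡c {xs = y ∷ z ∷ zs} _ =
  ≡.trans (≡.cong₂ _⊔_ (f≡c y) (foldr-⊔-map-const f f≡c {xs = z ∷ zs} (here ≡.refl))) (⊔-idem _)

rotate : ∀ {a} {A : Set a} → List A → List A
rotate []       = []
rotate (x ∷ xs) = xs ∷ʳ x

module _ {a} {A : Set a} where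

  rotate-++ : ∀ (xs ys : List A) → fold (xs ++ ys) rotate (length xs) ≡ ys ++ xs
  rotate-++ []       ys = ≡.sym (++-identityʳ ys)
  rotate-++ (x ∷ xs) ys = begin
    fold (x ∷ xs ++ ys) rotate (suc (length xs)) ≡⟨ cong (fold _ rotate) (+-comm 1 (length xs)) ⟩
    fold (x ∷ xs ++ ys) rotate (length xs + 1)   ≡⟨ fold-+ _ rotate (length xs) ⟩
    fold ((xs ++ ys) ∷ʳ x) rotate (length xs)    ≡⟨ cong (λ zs → fold zs rotate (length xs)) (++-assoc xs ys [ x ]) ⟩
    fold (xs ++ ys ∷ʳ x) rotate (length xs)      ≡⟨ rotate-++ xs (ys ∷ʳ x) ⟩
    (ys ∷ʳ x) ++ xs                              ≡⟨ ++-assoc ys [ x ] xs ⟩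
    ys ++ x ∷ xs                                 ∎
    where open ≡.≡-Reasoning

  rotate-length : ∀ (xs : List A) → fold xs rotate (length xs) ≡ xs
  rotate-length xs = ≡.trans (cong (λ ys → fold ys rotate (length xs)) (≡.sym (++-identityʳ xs))) (rotate-++ xs [])

  rotate-replicate : ∀ k (x : A) → rotate (replicate k x) ≡ replicate k x
  rotate-replicate zero    x = ≡.refl
  rotate-replicate (suc k) x = replicate-∷ʳ k
    where
    replicate-∷ʳ : ∀ k → replicate k x ∷ʳ x ≡ x ∷ replicate k x
    replicate-∷ʳ zero    = ≡.refl
    replicate-∷ʳ (suc k) = cong (x ∷_) (replicate-∷ʳ k)

module _ {c ℓ} (S : Setoid c ℓ) where
  open Setoid S
  open Membership S using (_∈_; _─_)
  open UniqueSetoid S using (Unique)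
  open SetoidEquality S using (_≋_; ++⁺)

  ∈-─ : ∀ {x y ys} (x∈ys : x ∈ ys) → y ∈ ys → ¬ y ≈ x → y ∈ ys ─ x∈ys
  ∈-─ (here x≈z) (here y≈z) y≉x = ⊥-elim (y≉x (trans y≈z (sym x≈z)))
  ∈-─ (here _)   (there y∈) _   = y∈
  ∈-─ (there _)  (here y≈z) _   = here y≈z
  ∈-─ (there x∈) (there y∈) y≉x = there (∈-─ x∈ y∈ y≉x)

  unique-length-≤ : ∀ {xs ys} → Unique xs → All (_∈ ys) xs → length xs ≤ length ys
  unique-length-≤ [] [] = z≤n
  unique-length-≤ {x ∷ xs} {ys} (x≉xs ∷ xs!) (x∈ys ∷ xs⊆ys) = begin
    suc (length xs)          ≤⟨ s≤s (unique-length-≤ xs! xs⊆ys─x) ⟩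
    suc (length (ys ─ x∈ys)) ≡⟨ length-removeAt′ ys (index x∈ys) ⟨
    length ys                ∎
    where
    open ≤-Reasoning
    xs⊆ys─x : All (_∈ ys ─ x∈ys) xs
    xs⊆ys─x = All.zipWith (λ (x≉y , y∈ys) → ∈-─ x∈ys y∈ys (x≉y ∘ sym)) (x≉xs , xs⊆ys)

  unique-length-≡ : ∀ {xs ys} → Unique xs → Unique ys → All (_∈ ys) xs → All (_∈ xs) ys → length xs ≡ length ys
  unique-length-≡ xs! ys! xs⊆ys ys⊆xs = ≤-antisym (unique-length-≤ xs! xs⊆ys) (unique-length-≤ ys! ys⊆xs)

  rotate-cong : ∀ {xs ys} → xs ≋ ys → rotate xs ≋ rotate ys
  rotate-cong []            = []
  rotate-cong (x≈y ∷ xs≋ys) = ++⁺ xs≋ys (x≈y ∷ [])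

  ∷ʳ≋∷⇒constant : ∀ {x y xs} → xs ∷ʳ x ≋ y ∷ xs → All (_≈ y) xs × x ≈ y
  ∷ʳ≋∷⇒constant {xs = []}     (x≈y ∷ [])          = [] , x≈y
  ∷ʳ≋∷⇒constant {xs = z ∷ xs} (z≈y ∷ xs∷ʳx≋z∷xs) with ∷ʳ≋∷⇒constant xs∷ʳx≋z∷xs
  ... | xs≈z , x≈z = z≈y ∷ All.map (λ w≈z → trans w≈z z≈y) xs≈z , trans x≈z z≈y

  rotate-invariant⇒replicate : ∀ {x xs} → rotate (x ∷ xs) ≋ x ∷ xs → x ∷ xs ≋ replicate (suc (length xs)) x
  rotate-invariant⇒replicate {x} xs∷ʳx≋x∷xs = refl ∷ ≋-replicate (proj₁ (∷ʳ≋∷⇒constant xs∷ʳx≋x∷xs))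
    where
    ≋-replicate : ∀ {ys} → All (_≈ x) ys → ys ≋ replicate (length ys) x
    ≋-replicate []           = []
    ≋-replicate (y≈x ∷ ys≈x) = y≈x ∷ ≋-replicate ys≈x

-- Iterating a map on a decidable setoid

module Iteration {c ℓ} (S : DecSetoid c ℓ) (r : DecSetoid.Carrier S → DecSetoid.Carrier S)
                 (r-cong : ∀ {x y} → DecSetoid._≈_ S x y → DecSetoid._≈_ S (r x) (r y)) where
  open DecSetoid S renaming (Carrier to A)
  open Membership setoid using (_∈_; find)
  open DecMembership S using (_∈?_)
  open UniqueSetoid setoid using (Unique)

  iter : ℕ → A → A
  iter k x = fold x r k

  iter-+ : ∀ j k x → iter (j + k) x ≡ iter j (iter k x)
  iter-+ j k x = fold-+ x r j

  iter-cong : ∀ k {x y} → x ≈ y → iter k x ≈ iter k y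
  iter-cong zero    x≈y = x≈y
  iter-cong (suc k) x≈y = r-cong (iter-cong k x≈y)

  Fixed : A → Set ℓ
  Fixed x = r x ≈ x

  fixed? : Decidable Fixed
  fixed? x = r x ≟ x

  fixed-resp : Fixed Respects _≈_
  fixed-resp x≈y rx≈x = trans (r-cong (sym x≈y)) (trans rx≈x x≈y)

  record Periodic (k : ℕ) (x : A) : Set ℓ where
    constructor periodic
    field iter≈ : iter k x ≈ x
  open Periodic public

  fixed⇒periodic : ∀ {x} → Fixed x → ∀ k → Periodic k x
  fixed⇒periodic fx zero    = periodic refl
  fixed⇒periodic fx (suc k) = periodic (trans (r-cong (iter≈ (fixed⇒periodic fx k))) fx)

  periodic-resp : ∀ {k} → Periodic k Respects _≈_
  periodic-resp {k} x≈y (periodic px) = periodic (trans (iter-cong k (sym x≈y)) (trans px x≈y))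

  periodic-≡ : ∀ {j k x} → j ≡ k → Periodic j x → Periodic k x
  periodic-≡ ≡.refl pj = pj

  periodic-+ : ∀ {j k x} → Periodic j x → Periodic k x → Periodic (j + k) x
  periodic-+ {j} {k} {x} (periodic pj) (periodic pk) =
    periodic (subst (_≈ x) (≡.sym (iter-+ j k x)) (trans (iter-cong j pk) pj))

  periodic-* : ∀ q {k x} → Periodic k x → Periodic (q * k) x
  periodic-* zero    pk = periodic refl
  periodic-* (suc q) pk = periodic-+ pk (periodic-* q pk)

  periodic-∸ : ∀ {j k x} → Periodic j x → Periodic (j + k) x → Periodic k x
  periodic-∸ {j} {k} {x} (periodic pj) (periodic pjk) = periodic (begin
    iter k x          ≈⟨ iter-cong k pj ⟨
    iter k (iter j x) ≡⟨ iter-+ k j x ⟨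
    iter (k + j) x    ≡⟨ cong (λ n → iter n x) (+-comm k j) ⟩
    iter (j + k) x    ≈⟨ pjk ⟩
    x                 ∎)
    where open SetoidReasoning setoid

  module _ {p} (p-prime : Prime p) where
    private instance _ = prime⇒nonZero p-prime

    -- The periods of x form a set closed under + and ∸, and 1 is a combination of p and k (Bézout).
    periodic⇒fixed : ∀ {k x} → Periodic p x → 0 < k → k < p → Periodic k x → Fixed x
    periodic⇒fixed {suc _} pp _ k<p pk with coprime-Bézout (prime⇒coprime p-prime k<p)
    ... | Bézout.+- a b 1+bk≡ap =
      iter≈ (periodic-∸ (periodic-* b pk) (periodic-≡ (≡.trans (≡.sym 1+bk≡ap) (+-comm 1 _)) (periodic-* a pp)))
    ... | Bézout.-+ a b 1+ap≡bk =
      iter≈ (periodic-∸ (periodic-* a pp) (periodic-≡ (≡.trans (≡.sym 1+ap≡bk) (+-comm 1 _)) (periodic-* b pk)))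

    iter-% : ∀ k {x} → Periodic p x → iter k x ≈ iter (k % p) x
    iter-% k {x} pp = begin
      iter k x                          ≡⟨ cong (λ n → iter n x) (m≡m%n+[m/n]*n k p) ⟩
      iter (k % p + k / p * p) x        ≡⟨ iter-+ (k % p) (k / p * p) x ⟩
      iter (k % p) (iter (k / p * p) x) ≈⟨ iter-cong (k % p) (iter≈ (periodic-* (k / p) pp)) ⟩
      iter (k % p) x                    ∎
      where open SetoidReasoning setoid

    module Orbit {x} (px : Periodic p x) (¬fx : ¬ Fixed x) where

      orbit : List A
      orbit = applyUpTo (λ k → iter k x) p

      iter-injective : ∀ {i j} → i < j → j < p → ¬ iter i x ≈ iter j x
      iter-injective {i} {j} i<j j<p xᵢ≈xⱼ = ¬fx (periodic⇒fixed px 0<e e<p (periodic xₑ≈x))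
        where
        e : ℕ
        e = p ∸ j + i
        xₑ≈x : iter e x ≈ x
        xₑ≈x = begin
          iter (p ∸ j + i) x      ≡⟨ iter-+ (p ∸ j) i x ⟩
          iter (p ∸ j) (iter i x) ≈⟨ iter-cong (p ∸ j) xᵢ≈xⱼ ⟩
          iter (p ∸ j) (iter j x) ≡⟨ iter-+ (p ∸ j) j x ⟨
          iter (p ∸ j + j) x      ≡⟨ cong (λ n → iter n x) (m∸n+n≡m (<⇒≤ j<p)) ⟩
          iter p x                ≈⟨ iter≈ px ⟩
          x                       ∎
          where open SetoidReasoning setoid
        0<e : 0 < e
        0<e = ≤-trans (m<n⇒0<n∸m j<p) (m≤m+n (p ∸ j) i)
        e<p : e < p
        e<p = subst (e <_) (m∸n+n≡m (<⇒≤ j<p)) (+-monoʳ-< (p ∸ j) i<j)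

      orbit-unique : Unique orbit
      orbit-unique = AllPairs.applyUpTo⁺₁ _ p iter-injective

      length-orbit : length orbit ≡ p
      length-orbit = length-applyUpTo _ p

      iter∈orbit : ∀ k → iter k x ∈ orbit
      iter∈orbit k = ∈-resp-≈ setoid (sym (iter-% k px)) (∈-applyUpTo⁺ setoid (λ k → iter k x) (m%n<n k p))

      ∈-orbit⁻ : ∀ {y} → y ∈ orbit → ∃ λ k → k < p × y ≈ iter k x
      ∈-orbit⁻ = ∈-applyUpTo⁻ setoid _

      fixed∉orbit : ∀ {y} → Fixed y → ¬ y ∈ orbit
      fixed∉orbit {y} fy y∈orbit with ∈-orbit⁻ y∈orbit
      ... | k , k<p , y≈xₖ = ¬fx (trans (r-cong x≈y) (trans fy (sym x≈y)))
        where
        x≈y : x ≈ y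
        x≈y = begin
          x                       ≈⟨ iter≈ px ⟨
          iter p x                ≡⟨ cong (λ n → iter n x) (m∸n+n≡m (<⇒≤ k<p)) ⟨
          iter (p ∸ k + k) x      ≡⟨ iter-+ (p ∸ k) k x ⟩
          iter (p ∸ k) (iter k x) ≈⟨ iter-cong (p ∸ k) y≈xₖ ⟨
          iter (p ∸ k) y          ≈⟨ iter≈ (fixed⇒periodic fy (p ∸ k)) ⟩
          y                       ∎
          where open SetoidReasoning setoid

      ∈-orbit-preimage : ∀ {y} → Periodic p y → r y ∈ orbit → y ∈ orbit
      ∈-orbit-preimage {y} py ry∈orbit with ∈-orbit⁻ ry∈orbit
      ... | k , _ , ry≈xₖ = ∈-resp-≈ setoid xₚ₋₁₊ₖ≈y (iter∈orbit (p ∸ 1 + k))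
        where
        xₚ₋₁₊ₖ≈y : iter (p ∸ 1 + k) x ≈ y
        xₚ₋₁₊ₖ≈y = begin
          iter (p ∸ 1 + k) x      ≡⟨ iter-+ (p ∸ 1) k x ⟩
          iter (p ∸ 1) (iter k x) ≈⟨ iter-cong (p ∸ 1) ry≈xₖ ⟨
          iter (p ∸ 1) (r y)      ≡⟨ iter-+ (p ∸ 1) 1 y ⟨
          iter (p ∸ 1 + 1) y      ≡⟨ cong (λ n → iter n y) (m∸n+n≡m (>-nonZero⁻¹ p)) ⟩
          iter p y                ≈⟨ iter≈ py ⟩
          y                       ∎
          where open SetoidReasoning setoid

      orbit-covers : ∀ {U} → (∀ y → y ∈ U) → length U ≤ p → ∀ y → y ∈ orbit
      orbit-covers {U} ∈U |U|≤p y with y ∈? orbit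
      ... | yes y∈orbit = y∈orbit
      ... | no  y∉orbit = ⊥-elim (<-irrefl ≡.refl (begin-strict
        p                  ≡⟨ length-orbit ⟨
        length orbit       <⟨ n<1+n _ ⟩
        length (y ∷ orbit) ≤⟨ unique-length-≤ setoid y∷orbit-unique (All.universal ∈U _) ⟩
        length U           ≤⟨ |U|≤p ⟩
        p                  ∎))
        where
        open ≤-Reasoning
        y∷orbit-unique : Unique (y ∷ orbit)
        y∷orbit-unique = ∉⇒All[≉] setoid y∉orbit ∷ orbit-unique

    module RemoveOrbit {L : List A} (L! : Unique L) (L-closed : All (λ y → r y ∈ L) L) (L-periodic : All (Periodic p) L)
                       {x} (x∈L : x ∈ L) (px : Periodic p x) (¬fx : ¬ Fixed x) where
      open Orbit px ¬fx

      iter∈L : ∀ k → iter k x ∈ L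
      iter∈L zero    = x∈L
      iter∈L (suc k) = All.lookupₛ setoid (λ y≈z → ∈-resp-≈ setoid (r-cong y≈z)) L-closed (iter∈L k)

      _∉orbit? : Decidable (λ y → ¬ y ∈ orbit)
      _∉orbit? = ∁? (_∈? orbit)

      rest : List A
      rest = filter _∉orbit? L

      length-in-orbit : length (filter (_∈? orbit) L) ≡ p
      length-in-orbit = ≡.trans
        (unique-length-≡ setoid (AllPairs.filter⁺ (_∈? orbit) L!) orbit-unique (All.all-filter (_∈? orbit) L)
          (All.applyUpTo⁺₁ (λ k → iter k x) p λ {k} _ →
            ∈-filter⁺ setoid (_∈? orbit) (∈-resp-≈ setoid) (iter∈L k) (iter∈orbit k)))
        length-orbit

      length-rest : length L ≡ p + length rest
      length-rest = ≡.trans (≡.sym (length-filter-∁ (_∈? orbit) L)) (cong (_+ length rest) length-in-orbit)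

      rest-unique : Unique rest
      rest-unique = AllPairs.filter⁺ _∉orbit? L!

      rest-closed : All (λ y → r y ∈ rest) rest
      rest-closed = All.zipWith step (All.filter⁺ _∉orbit? (All.zip (L-closed , L-periodic)) , All.all-filter _∉orbit? L)
        where
        step : ∀ {y} → (r y ∈ L × Periodic p y) × ¬ y ∈ orbit → r y ∈ rest
        step ((ry∈L , py) , y∉orbit) =
          ∈-filter⁺ setoid _∉orbit? (∉-resp-≈ setoid) ry∈L (y∉orbit ∘ ∈-orbit-preimage py)

      rest-periodic : All (Periodic p) rest
      rest-periodic = All.filter⁺ _∉orbit? L-periodic

      filter-fixed-rest : filter fixed? rest ≡ filter fixed? L
      filter-fixed-rest = filter-filter-⊆ fixed? _∉orbit? fixed∉orbit L

    -- The non-fixed points fall into orbits of size exactly p.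
    fixed-count : ∀ {L} → Unique L → All (λ y → r y ∈ L) L → All (Periodic p) L →
                  ∃ λ q → length L ≡ length (filter fixed? L) + q * p
    fixed-count {L} = go (<-wellFounded (length L))
      where
      go : ∀ {L} → Acc _<_ (length L) → Unique L → All (λ y → r y ∈ L) L → All (Periodic p) L →
           ∃ λ q → length L ≡ length (filter fixed? L) + q * p
      go {L} (acc rec) L! L-closed L-periodic with All.all? fixed? L
      ... | yes all-fixed = 0 , ≡.sym (≡.trans (+-identityʳ _) (cong length (filter-all fixed? all-fixed)))
      ... | no ¬all-fixed with find (¬All⇒Any¬ fixed? L ¬all-fixed)
      ... | x , x∈L , ¬fx = suc q , (begin
        length L                                  ≡⟨ length-rest ⟩
        p + length rest                           ≡⟨ cong (p +_) |rest|≡ ⟩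
        p + (length (filter fixed? rest) + q * p) ≡⟨ cong (λ xs → p + (length xs + q * p)) filter-fixed-rest ⟩
        p + (length (filter fixed? L) + q * p)    ≡⟨ x∙yz≈y∙xz +-commutativeSemigroup p _ (q * p) ⟩
        length (filter fixed? L) + suc q * p      ∎)
        where
        open ≡.≡-Reasoning
        open RemoveOrbit L! L-closed L-periodic x∈L (All.lookupₛ setoid periodic-resp L-periodic x∈L) ¬fx
        rest<L : length rest < length L
        rest<L = subst (length rest <_) (≡.sym length-rest) (m<n+m (length rest) (>-nonZero⁻¹ p))
        q : ℕ
        q = proj₁ (go (rec rest<L) rest-unique rest-closed rest-periodic)
        |rest|≡ : length rest ≡ length (filter fixed? rest) + q * p
        |rest|≡ = proj₂ (go (rec rest<L) rest-unique rest-closed rest-periodic)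

≈ₚ-setoid : ℕ → Setoid 0ℓ 0ℓ
≈ₚ-setoid n = record
  { Carrier       = Permutation′ n
  ; _≈_           = _≈ₚ_
  ; isEquivalence = record
    { refl  = λ _ → ≡.refl
    ; sym   = λ g≈h i → ≡.sym (g≈h i)
    ; trans = λ g≈h h≈k i → ≡.trans (g≈h i) (h≈k i)
    }
  }

≈ₚ-decSetoid : ℕ → DecSetoid 0ℓ 0ℓ
≈ₚ-decSetoid n = record
  { isDecEquivalence = record
    { isEquivalence = Setoid.isEquivalence (≈ₚ-setoid n)
    ; _≟_           = λ g h → all? (λ i → g ⟨$⟩ʳ i ≟ᶠ h ⟨$⟩ʳ i)
    }
  }

module _ {n : ℕ} where

  ∘ₚ-cong : ∀ {g g′ h h′ : Permutation′ n} → g ≈ₚ g′ → h ≈ₚ h′ → g ∘ₚ h ≈ₚ g′ ∘ₚ h′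
  ∘ₚ-cong {h = h} g≈g′ h≈h′ i = ≡.trans (cong (h ⟨$⟩ʳ_) (g≈g′ i)) (h≈h′ _)

  ∘ₚ-cancelʳ : ∀ {g h : Permutation′ n} (u : Permutation′ n) → g ∘ₚ u ≈ₚ h ∘ₚ u → g ≈ₚ h
  ∘ₚ-cancelʳ u gu≈hu i = ≡.trans (≡.sym (inverseˡ u)) (≡.trans (cong (u ⟨$⟩ˡ_) (gu≈hu i)) (inverseˡ u))

  ∘ₚ≈id⇒≈flip : ∀ (g h : Permutation′ n) → g ∘ₚ h ≈ₚ id → g ≈ₚ flip h
  ∘ₚ≈id⇒≈flip g h gh≈id i = ≡.trans (≡.sym (inverseˡ h)) (cong (h ⟨$⟩ˡ_) (gh≈id i))

  ∘ₚ≈id-comm : ∀ (g h : Permutation′ n) → g ∘ₚ h ≈ₚ id → h ∘ₚ g ≈ₚ id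
  ∘ₚ≈id-comm g h gh≈id i = ≡.trans (∘ₚ≈id⇒≈flip g h gh≈id (h ⟨$⟩ʳ i)) (inverseˡ h)

  flip-cong : ∀ {g h : Permutation′ n} → g ≈ₚ h → flip g ≈ₚ flip h
  flip-cong {g} {h} g≈h = ∘ₚ≈id⇒≈flip (flip g) h (λ i → ≡.trans (≡.sym (g≈h _)) (inverseʳ g))

  prod : List (Permutation′ n) → Permutation′ n
  prod = foldr _∘ₚ_ id

  prod-cong : ∀ {xs ys} → SetoidEquality._≋_ (≈ₚ-setoid n) xs ys → prod xs ≈ₚ prod ys
  prod-cong = SetoidEquality.foldr⁺ (≈ₚ-setoid n) (λ {g} {g′} {h} {h′} → ∘ₚ-cong {g} {g′} {h} {h′})
    (λ _ → ≡.refl)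

  prod-∷ʳ : ∀ xs (x : Permutation′ n) → prod (xs ∷ʳ x) ≈ₚ prod xs ∘ₚ x
  prod-∷ʳ []       x i = ≡.refl
  prod-∷ʳ (y ∷ xs) x i = prod-∷ʳ xs x (y ⟨$⟩ʳ i)

  _^ₚ_ : Permutation′ n → ℕ → Permutation′ n
  c ^ₚ k = prod (replicate k c)

  id-^ₚ : ∀ k → id ^ₚ k ≈ₚ id
  id-^ₚ zero    i = ≡.refl
  id-^ₚ (suc k) i = id-^ₚ k i

  ^ₚ-⟨$⟩ʳ : ∀ c k i → (c ^ₚ k) ⟨$⟩ʳ i ≡ fold i (c ⟨$⟩ʳ_) k
  ^ₚ-⟨$⟩ʳ c zero    i = ≡.refl
  ^ₚ-⟨$⟩ʳ c (suc k) i = ≡.trans (^ₚ-⟨$⟩ʳ c k (c ⟨$⟩ʳ i)) (fold-sucˡ k)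
    where
    fold-sucˡ : ∀ {x} k → fold (c ⟨$⟩ʳ x) (c ⟨$⟩ʳ_) k ≡ fold x (c ⟨$⟩ʳ_) (suc k)
    fold-sucˡ zero    = ≡.refl
    fold-sucˡ (suc k) = cong (c ⟨$⟩ʳ_) (fold-sucˡ k)

  open Membership (≈ₚ-setoid n) using (_∈_)
  open UniqueSetoid (≈ₚ-setoid n) using (Unique)

  PairwiseNonIntersecting : (Fin n → Permutation′ n) → Set
  PairwiseNonIntersecting t = ∀ {i j} → i ≢ j → ∀ γ → t i ⟨$⟩ʳ γ ≢ t j ⟨$⟩ʳ γ

  translates : List (Permutation′ n) → (Fin n → Permutation′ n) → List (Permutation′ n)
  translates X t = concatMap (λ i → map (_∘ₚ t i) X) (allFin n)

  Separated : (Fin n → Permutation′ n) → List (Permutation′ n) → Set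
  Separated t X = ∀ {i j} → i ≢ j → All (λ x → All (λ y → ¬ x ∘ₚ t i ≈ₚ y ∘ₚ t j) X) X

  length-translates : ∀ X t → length (translates X t) ≡ n * length X
  length-translates X t = ≡.trans
    (length-concatMap-const (λ i → map (_∘ₚ t i) X) (λ i → length-map _ X) (allFin n))
    (cong (_* length X) (length-tabulate {n = n} (λ i → i)))

  translates-unique : ∀ X t → Unique X → Separated t X → Unique (translates X t)
  translates-unique X t X! separated = AllPairs.concat⁺
    (All.map⁺ (All.universal (λ i → AllPairs.map⁺
      (AllPairs.map (λ {x} {y} x≉y → x≉y ∘ ∘ₚ-cancelʳ {x} {y} (t i)) X!)) (allFin n)))
    (AllPairs.map⁺ (AllPairs.map (λ {i} {j} i≢j → All.map⁺ (All.map (All.map⁺ {f = _∘ₚ t j}) (separated i≢j)))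
      (allFin⁺ n)))

  ∈-translates : ∀ X t {g x} i → x ∈ X → g ≈ₚ x ∘ₚ t i → g ∈ translates X t
  ∈-translates X t {g} {x} i x∈X g≈xtᵢ =
    ∈-concatMap⁺ (≡.setoid (Fin n)) (≈ₚ-setoid n) {f = λ i → map (_∘ₚ t i) X} {xs = allFin n} {y = g}
      (Any.map (λ { ≡.refl → ∈-resp-≈ (≈ₚ-setoid n) {x = x ∘ₚ t i} {y = g} (λ j → ≡.sym (g≈xtᵢ j))
                               (∈-map⁺ (≈ₚ-setoid n) (≈ₚ-setoid n) {f = _∘ₚ t i}
                                 (λ y≈z k → cong (t i ⟨$⟩ʳ_) (y≈z k)) {v = x} {xs = X} x∈X) })
        (∈-allFin i))

module _ {n : ℕ} (G : PermGroup n) where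
  open Membership (≈ₚ-setoid n) using (_∈_)
  open UniqueSetoid (≈ₚ-setoid n) using (Unique)

  prod-∈ : ∀ {xs} → All (_∈ elems G) xs → prod xs ∈ elems G
  prod-∈ []                   = hasId G
  prod-∈ {x ∷ xs} (x∈G ∷ xs∈G) = closed∘ G x (prod xs) x∈G (prod-∈ xs∈G)

  ^ₚ-∈ : ∀ {c} → c ∈ elems G → ∀ k → c ^ₚ k ∈ elems G
  ^ₚ-∈ c∈G k = prod-∈ (All.replicate⁺ k c∈G)

  translates-⊆ : ∀ X t → All (_∈ elems G) X → (∀ i → t i ∈ elems G) → All (_∈ elems G) (translates X t)
  translates-⊆ X t X⊆G t∈G = All.concat⁺ (All.map⁺ (All.universal
    (λ i → All.map⁺ (All.map (λ {x} x∈G → closed∘ G x (t i) x∈G (t∈G i)) X⊆G)) (allFin n)))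

  translates-≤ : ∀ X t → Unique X → Separated t X → All (_∈ elems G) X → (∀ i → t i ∈ elems G) →
                 n * length X ≤ length (elems G)
  translates-≤ X t X! separated X⊆G t∈G = subst (_≤ length (elems G)) (length-translates X t)
    (unique-length-≤ (≈ₚ-setoid n) (translates-unique X t X! separated) (translates-⊆ X t X⊆G t∈G))

  stabilizer : Fin n → List (Permutation′ n)
  stabilizer ω = filter (λ g → g ⟨$⟩ʳ ω ≟ᶠ ω) (elems G)

  stabilizer-unique : ∀ ω → Unique (stabilizer ω)
  stabilizer-unique ω = AllPairs.filter⁺ _ (distinct G)

  stabilizer-⊆ : ∀ ω → All (_∈ elems G) (stabilizer ω)
  stabilizer-⊆ ω = All.filter⁺ _ (All.tabulateₛ (≈ₚ-setoid n) (λ g∈G → g∈G))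

  stabilizer-fixes : ∀ ω → All (λ g → g ⟨$⟩ʳ ω ≡ ω) (stabilizer ω)
  stabilizer-fixes ω = All.all-filter _ (elems G)

  ∈-stabilizer : ∀ {g} ω → g ∈ elems G → g ⟨$⟩ʳ ω ≡ ω → g ∈ stabilizer ω
  ∈-stabilizer {g} ω = ∈-filter⁺ (≈ₚ-setoid n) (λ g → g ⟨$⟩ʳ ω ≟ᶠ ω)
    (λ x≈y xω≡ω → ≡.trans (≡.sym (x≈y ω)) xω≡ω) {v = g} {xs = elems G}

  stabilizer-intersecting : ∀ ω → IsIntersectingSubset G (stabilizer ω)
  stabilizer-intersecting ω = stabilizer-unique ω , stabilizer-⊆ ω ,
    All.map (λ gω≡ω → All.map (λ hω≡ω → ω , ≡.trans gω≡ω (≡.sym hω≡ω)) (stabilizer-fixes ω))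
      (stabilizer-fixes ω)

  0<stabSize : ∀ ω → 0 < stabSize G ω
  0<stabSize ω = ∈-length (≈ₚ-setoid n) {x = id} {xs = stabilizer ω} (∈-stabilizer {id} ω (hasId G) ≡.refl)

  -- The translates F·t i are pairwise disjoint (the clique–coclique bound).
  intersecting-≤ : ∀ {F} t → IsIntersectingSubset G F → (∀ i → t i ∈ elems G) → PairwiseNonIntersecting t →
                   n * length F ≤ length (elems G)
  intersecting-≤ {F} t (F! , F⊆G , F-intersecting) t∈G t-clique = translates-≤ F t F! separated F⊆G t∈G
    where
    separated : Separated t F
    separated {i} {j} i≢j = All.map (All.map λ { (γ , fγ≡f′γ) ftᵢ≈f′tⱼ →
      t-clique i≢j _ (≡.trans (ftᵢ≈f′tⱼ γ) (cong (t j ⟨$⟩ʳ_) (≡.sym fγ≡f′γ))) }) F-intersecting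

  module OrbitStabilizer (transitive : Transitive G) (ω : Fin n) where

    private
      u : Fin n → Permutation′ n
      u β = proj₁ (transitive ω β)

      u∈G : ∀ β → u β ∈ elems G
      u∈G β = proj₁ (proj₂ (transitive ω β))

      uω≡ : ∀ β → u β ⟨$⟩ʳ ω ≡ β
      uω≡ β = proj₂ (proj₂ (transitive ω β))

    stabilizer-separated : Separated u (stabilizer ω)
    stabilizer-separated {i} {j} i≢j = All.map (λ {x} xω≡ω → All.map (λ {y} yω≡ω xuᵢ≈yuⱼ → i≢j (begin
      i                  ≡⟨ uω≡ i ⟨
      u i ⟨$⟩ʳ ω         ≡⟨ cong (u i ⟨$⟩ʳ_) xω≡ω ⟨
      (x ∘ₚ u i) ⟨$⟩ʳ ω  ≡⟨ xuᵢ≈yuⱼ ω ⟩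
      (y ∘ₚ u j) ⟨$⟩ʳ ω  ≡⟨ cong (u j ⟨$⟩ʳ_) yω≡ω ⟩
      u j ⟨$⟩ʳ ω         ≡⟨ uω≡ j ⟩
      j                  ∎)) (stabilizer-fixes ω)) (stabilizer-fixes ω)
      where open ≡.≡-Reasoning

    -- g = (g · u_β⁻¹) · u_β with β = g ω, and g · u_β⁻¹ fixes ω.
    G⊆translates : All (_∈ translates (stabilizer ω) u) (elems G)
    G⊆translates = All.tabulateₛ (≈ₚ-setoid n) λ {g} g∈G →
      let β = g ⟨$⟩ʳ ω
          h = g ∘ₚ flip (u β)
          h∈stabilizer = ∈-stabilizer {h} ω (closed∘ G g (flip (u β)) g∈G (closed⁻¹ G (u β) (u∈G β)))
                           (≡.trans (cong (u β ⟨$⟩ˡ_) (≡.sym (uω≡ β))) (inverseˡ (u β)))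
      in ∈-translates (stabilizer ω) u {g} {h} β h∈stabilizer (λ _ → ≡.sym (inverseʳ (u β)))

    orbit-stabilizer : length (elems G) ≡ n * stabSize G ω
    orbit-stabilizer = ≤-antisym
      (subst (length (elems G) ≤_) (length-translates (stabilizer ω) u)
        (unique-length-≤ (≈ₚ-setoid n) (distinct G) G⊆translates))
      (translates-≤ (stabilizer ω) u (stabilizer-unique ω) stabilizer-separated (stabilizer-⊆ ω) u∈G)

    degree∣order : n ∣ length (elems G)
    degree∣order = divides (stabSize G ω) (≡.trans orbit-stabilizer (*-comm n _))

  module _ .{{_ : NonZero n}} (transitive : Transitive G) where
    open OrbitStabilizer transitive using (orbit-stabilizer)

    stabSize-constant : ∀ ω ω′ → stabSize G ω ≡ stabSize G ω′
    stabSize-constant ω ω′ = *-cancelˡ-≡ (stabSize G ω) (stabSize G ω′) n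
      (≡.trans (≡.sym (orbit-stabilizer ω)) (orbit-stabilizer ω′))

    maxStab≡stabSize : ∀ ω → maxStab G ≡ stabSize G ω
    maxStab≡stabSize ω = foldr-⊔-map-const (stabSize G) (λ ω′ → stabSize-constant ω′ ω) (∈-allFin ω)

    intersecting-≤-stabSize : ∀ {F} t → IsIntersectingSubset G F → (∀ i → t i ∈ elems G) →
                              PairwiseNonIntersecting t → ∀ ω → length F ≤ stabSize G ω
    intersecting-≤-stabSize t F-intersecting t∈G t-clique ω =
      *-cancelˡ-≤ n (subst (_ ≤_) (orbit-stabilizer ω) (intersecting-≤ t F-intersecting t∈G t-clique))

-- Cauchy's theorem

module Cauchy {n} (G : PermGroup n) where
  open DecSetoid (≈ₚ-decSetoid n) using () renaming (_≟_ to _≟ₚ_)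
  open Membership (≈ₚ-setoid n) using (_∈_)
  open SetoidEquality (≈ₚ-setoid n) using (_≋_; ≋-setoid; ≋-sym; ≋-trans)
  open Membership ≋-setoid using () renaming (_∈_ to _∈ₜ_)
  open UniqueSetoid ≋-setoid using () renaming (Unique to Uniqueₜ)

  Tuple : ℕ → List (Permutation′ n) → Set
  Tuple k u = length u ≡ k × All (_∈ elems G) u

  tuples : ℕ → List (List (Permutation′ n))
  tuples zero    = [ [] ]
  tuples (suc k) = concatMap (λ g → map (g ∷_) (tuples k)) (elems G)

  length-tuples : ∀ k → length (tuples k) ≡ length (elems G) ^ k
  length-tuples zero    = ≡.refl
  length-tuples (suc k) = ≡.trans
    (length-concatMap-const (λ g → map (g ∷_) (tuples k)) (λ g → length-map (g ∷_) (tuples k)) (elems G))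
    (cong (length (elems G) *_) (length-tuples k))

  tuples-sound : ∀ k → All (Tuple k) (tuples k)
  tuples-sound zero    = (≡.refl , []) ∷ []
  tuples-sound (suc k) = All.concat⁺ (All.map⁺ (All.tabulateₛ (≈ₚ-setoid n) λ g∈G →
    All.map⁺ (All.map (λ (|u|≡k , u⊆G) → cong suc |u|≡k , g∈G ∷ u⊆G) (tuples-sound k))))

  tuples-unique : ∀ k → Uniqueₜ (tuples k)
  tuples-unique zero    = [] ∷ []
  tuples-unique (suc k) = AllPairs.concat⁺
    (All.map⁺ (All.universal (λ _ → AllPairs.map⁺
      (AllPairs.map (λ u≉v → λ { (_ ∷ u≋v) → u≉v u≋v }) (tuples-unique k))) (elems G)))
    (AllPairs.map⁺ (AllPairs.map (λ g≉h → All.map⁺ (All.universal (λ _ → All.map⁺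
      (All.universal (λ _ → λ { (g≈h ∷ _) → g≉h g≈h }) _)) _)) (distinct G)))

  ∈-tuples : ∀ k {u} → Tuple k u → u ∈ₜ tuples k
  ∈-tuples zero    {[]}    _                   = here []
  ∈-tuples (suc k) {g ∷ u} (|u|≡ , g∈G ∷ u⊆G) = ∈-concatMap⁺ (≈ₚ-setoid n) ≋-setoid
    (Any.map (λ g≈h → Any.map⁺ (Any.map (g≈h ∷_) (∈-tuples k (suc-injective |u|≡ , u⊆G)))) g∈G)

  Balanced : ℕ → List (Permutation′ n) → Set
  Balanced k u = Tuple k u × prod u ≈ₚ id

  -- The (k+1)-tuples with product 1, parametrised by their last k entries.
  balanced : ℕ → List (List (Permutation′ n))
  balanced k = map (λ t → flip (prod t) ∷ t) (tuples k)

  length-balanced : ∀ k → length (balanced k) ≡ length (elems G) ^ k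
  length-balanced k = ≡.trans (length-map _ (tuples k)) (length-tuples k)

  balanced-sound : ∀ k → All (Balanced (suc k)) (balanced k)
  balanced-sound k = All.map⁺ (All.map (λ {t} (|t|≡k , t⊆G) →
    (cong suc |t|≡k , closed⁻¹ G (prod t) (prod-∈ G t⊆G) ∷ t⊆G) , λ _ → inverseʳ (prod t))
    (tuples-sound k))

  balanced-unique : ∀ k → Uniqueₜ (balanced k)
  balanced-unique k = AllPairs.map⁺ (AllPairs.map (λ t≉t′ → λ { (_ ∷ t≋t′) → t≉t′ t≋t′ }) (tuples-unique k))

  ∈-balanced : ∀ k {u} → Balanced (suc k) u → u ∈ₜ balanced k
  ∈-balanced k {g ∷ t} ((|u|≡ , _ ∷ t⊆G) , gt≈id) = Any.map⁺ (Any.map (λ {t′} t≋t′ →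
      (λ i → ≡.trans (∘ₚ≈id⇒≈flip g (prod t) gt≈id i) (flip-cong {g = prod t} {h = prod t′} (prod-cong t≋t′) i))
      ∷ t≋t′)
    (∈-tuples k (suc-injective |u|≡ , t⊆G)))

  rotate-balanced : ∀ {k u} → Balanced k u → Balanced k (rotate u)
  rotate-balanced {u = []}    b = b
  rotate-balanced {u = g ∷ t} ((|u|≡k , g∈G ∷ t⊆G) , gt≈id) =
    (≡.trans (length-++ t) (≡.trans (+-comm (length t) 1) |u|≡k) , All.∷ʳ⁺ t⊆G g∈G) ,
    λ i → ≡.trans (prod-∷ʳ t g i) (∘ₚ≈id-comm g (prod t) gt≈id i)

  module RotationInvariants {m} (p-prime : Prime (suc m)) where
    private
      p : ℕ
      p = suc m
    open Iteration (≋-decSetoid (≈ₚ-decSetoid n)) rotate (rotate-cong (≈ₚ-setoid n))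

    balanced-periodic : All (Periodic p) (balanced m)
    balanced-periodic = All.map (λ {u} ((|u|≡p , _) , _) →
      periodic (Setoid.reflexive ≋-setoid (subst (λ k → fold u rotate k ≡ u) |u|≡p (rotate-length u))))
      (balanced-sound m)

    balanced-closed : All (λ u → rotate u ∈ₜ balanced m) (balanced m)
    balanced-closed = All.map (∈-balanced m ∘ rotate-balanced) (balanced-sound m)

    invariant : List (List (Permutation′ n))
    invariant = filter fixed? (balanced m)

    invariant⇒root : ∀ {u} → Balanced p u → Fixed u →
                     ∃ λ c → c ∈ elems G × u ≋ replicate p c × c ^ₚ p ≈ₚ id
    invariant⇒root {c ∷ cs} ((|u|≡p , c∈G ∷ _) , u≈id) u-fixed =
      c , c∈G , u≋cᵖ , λ i → ≡.trans (≡.sym (prod-cong u≋cᵖ i)) (u≈id i)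
      where
      u≋cᵖ : c ∷ cs ≋ replicate p c
      u≋cᵖ = subst (λ k → c ∷ cs ≋ replicate k c) |u|≡p (rotate-invariant⇒replicate (≈ₚ-setoid n) u-fixed)

    trivial∈invariant : replicate p id ∈ₜ invariant
    trivial∈invariant = ∈-filter⁺ ≋-setoid fixed? fixed-resp
      (∈-balanced m ((length-replicate p , All.replicate⁺ p (hasId G)) , id-^ₚ p))
      (Setoid.reflexive ≋-setoid (rotate-replicate p id))

    -- p divides |G|^(p-1), the number of tuples with product 1.
    p∣|invariant| : p ∣ length (elems G) → p ∣ length invariant
    p∣|invariant| p∣|G| with fixed-count p-prime (balanced-unique m) balanced-closed balanced-periodic
    ... | q , |balanced|≡ =
      ∣m+n∣m⇒∣n (subst (p ∣_) (≡.trans |balanced|≡ (+-comm _ (q * p))) p∣|balanced|) (n∣m*n q)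
      where
      p∣|G|^ : ∀ k → 1 < suc k → p ∣ length (elems G) ^ k
      p∣|G|^ zero    (s≤s ())
      p∣|G|^ (suc k) _ = ∣m⇒∣m*n _ p∣|G|
      p∣|balanced| : p ∣ length (balanced m)
      p∣|balanced| = subst (p ∣_) (≡.sym (length-balanced m)) (p∣|G|^ m (nonTrivial⇒n>1 p {{prime⇒nonTrivial p-prime}}))

    nontrivial-root : p ∣ length (elems G) → ∃ λ c → c ∈ elems G × c ^ₚ p ≈ₚ id × ¬ c ≈ₚ id
    nontrivial-root p∣|G| = two-invariants⇒root invariant 2≤|invariant|
      (AllPairs.filter⁺ fixed? (balanced-unique m)) (All.filter⁺ fixed? (balanced-sound m))
      (All.all-filter fixed? (balanced m))
      where
      2≤|invariant| : 2 ≤ length invariant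
      2≤|invariant| = ≤-trans (nonTrivial⇒n>1 p {{prime⇒nonTrivial p-prime}})
        (∣⇒≤ {{>-nonZero (∈-length ≋-setoid trivial∈invariant)}} (p∣|invariant| p∣|G|))
      two-invariants⇒root : ∀ us → 2 ≤ length us → Uniqueₜ us → All (Balanced p) us → All Fixed us →
                            ∃ λ c → c ∈ elems G × c ^ₚ p ≈ₚ id × ¬ c ≈ₚ id
      two-invariants⇒root []          ()
      two-invariants⇒root (_ ∷ [])    (s≤s ())
      two-invariants⇒root (u ∷ v ∷ _) _ ((u≉v ∷ _) ∷ _) (bu ∷ bv ∷ _) (fu ∷ fv ∷ _)
        with invariant⇒root bu fu | invariant⇒root bv fv
      ... | c , c∈G , u≋cᵖ , cᵖ≈id | d , d∈G , v≋dᵖ , dᵖ≈id with c ≟ₚ id | d ≟ₚ id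
      ... | no c≉id  | _        = c , c∈G , cᵖ≈id , c≉id
      ... | yes _    | no d≉id  = d , d∈G , dᵖ≈id , d≉id
      ... | yes c≈id | yes d≈id =
        ⊥-elim (u≉v (≋-trans u≋cᵖ (≋-trans (Pointwise.replicate⁺ c≈d p) (≋-sym v≋dᵖ))))
        where
        c≈d : c ≈ₚ d
        c≈d i = ≡.trans (c≈id i) (≡.sym (d≈id i))

  cauchy : ∀ {p} → Prime p → p ∣ length (elems G) → ∃ λ c → c ∈ elems G × c ^ₚ p ≈ₚ id × ¬ c ≈ₚ id
  cauchy {zero}  0-prime = ⊥-elim (¬prime[0] 0-prime)
  cauchy {suc m} p-prime = RotationInvariants.nontrivial-root p-prime

-- Elements of order p in degree p

module _ {p} (p-prime : Prime p) {c : Permutation′ p} (cᵖ≈id : c ^ₚ p ≈ₚ id) (c≉id : ¬ c ≈ₚ id) where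
  open Iteration (≡-decSetoid p) (c ⟨$⟩ʳ_) (cong (c ⟨$⟩ʳ_))

  private
    periodic-everywhere : ∀ γ → Periodic p γ
    periodic-everywhere γ = periodic (≡.trans (≡.sym (^ₚ-⟨$⟩ʳ c p γ)) (cᵖ≈id γ))

    -- The orbit of a moved point has p elements, so it is everything.
    fixed-point-free : ∀ γ → ¬ Fixed γ
    fixed-point-free γ γ-fixed with ¬∀⟶∃¬ p Fixed fixed? c≉id
    ... | α , α-moved = fixed∉orbit γ-fixed (orbit-covers ∈-allFin (≤-reflexive (length-tabulate {n = p} (λ i → i))) γ)
      where open Orbit p-prime (periodic-everywhere α) α-moved

    powers-injective : ∀ γ {i j} → i < j → j < p → (c ^ₚ i) ⟨$⟩ʳ γ ≢ (c ^ₚ j) ⟨$⟩ʳ γ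
    powers-injective γ {i} {j} i<j j<p cⁱγ≡cʲγ = iter-injective i<j j<p
      (≡.trans (≡.sym (^ₚ-⟨$⟩ʳ c i γ)) (≡.trans cⁱγ≡cʲγ (^ₚ-⟨$⟩ʳ c j γ)))
      where open Orbit p-prime (periodic-everywhere γ) (fixed-point-free γ)

  powers-nonIntersecting : PairwiseNonIntersecting (λ i → c ^ₚ toℕ i)
  powers-nonIntersecting {i} {j} i≢j γ with <-cmp (toℕ i) (toℕ j)
  ... | tri< i<j _ _ = powers-injective γ i<j (toℕ<n j)
  ... | tri≈ _ i≡j _ = λ _ → i≢j (toℕ-injective i≡j)
  ... | tri> _ _ j<i = powers-injective γ j<i (toℕ<n i) ∘ ≡.sym

-- The cyclic group of degree N

[m%n+k]%n≡[m+k]%n : ∀ m k n .{{_ : NonZero n}} → (m % n + k) % n ≡ (m + k) % n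
[m%n+k]%n≡[m+k]%n m k n = begin
  (m % n + k) % n         ≡⟨ %-distribˡ-+ (m % n) k n ⟩
  (m % n % n + k % n) % n ≡⟨ cong (λ z → (z + k % n) % n) (m%n%n≡m%n m n) ⟩
  (m % n + k % n) % n     ≡⟨ %-distribˡ-+ m k n ⟨
  (m + k) % n             ∎
  where open ≡.≡-Reasoning

module CyclicGroup (K : ℕ) where
  N : ℕ
  N = suc K
  open Membership (≈ₚ-setoid N) using (_∈_)

  infixl 6 _⊕_
  _⊕_ : Fin N → ℕ → Fin N
  x ⊕ a = (toℕ x + a) mod N

  toℕ-⊕ : ∀ x a → toℕ (x ⊕ a) ≡ (toℕ x + a) % N
  toℕ-⊕ x a = toℕ-fromℕ< _

  ⊕-% : ∀ x a → x ⊕ a % N ≡ x ⊕ a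
  ⊕-% x a = toℕ-injective (begin
    toℕ (x ⊕ a % N)     ≡⟨ toℕ-⊕ x (a % N) ⟩
    (toℕ x + a % N) % N ≡⟨ cong (_% N) (+-comm (toℕ x) (a % N)) ⟩
    (a % N + toℕ x) % N ≡⟨ [m%n+k]%n≡[m+k]%n a (toℕ x) N ⟩
    (a + toℕ x) % N     ≡⟨ cong (_% N) (+-comm a (toℕ x)) ⟩
    (toℕ x + a) % N     ≡⟨ toℕ-⊕ x a ⟨
    toℕ (x ⊕ a)         ∎)
    where open ≡.≡-Reasoning

  ⊕-+ : ∀ x a b → x ⊕ a ⊕ b ≡ x ⊕ (a + b)
  ⊕-+ x a b = toℕ-injective (begin
    toℕ (x ⊕ a ⊕ b)           ≡⟨ toℕ-⊕ (x ⊕ a) b ⟩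
    (toℕ (x ⊕ a) + b) % N     ≡⟨ cong (λ m → (m + b) % N) (toℕ-⊕ x a) ⟩
    ((toℕ x + a) % N + b) % N ≡⟨ [m%n+k]%n≡[m+k]%n (toℕ x + a) b N ⟩
    (toℕ x + a + b) % N       ≡⟨ cong (_% N) (+-assoc (toℕ x) a b) ⟩
    (toℕ x + (a + b)) % N     ≡⟨ toℕ-⊕ x (a + b) ⟨
    toℕ (x ⊕ (a + b))         ∎)
    where open ≡.≡-Reasoning

  ⊕-N : ∀ x → x ⊕ N ≡ x
  ⊕-N x = toℕ-injective (≡.trans (toℕ-⊕ x N) (≡.trans ([m+n]%n≡m%n (toℕ x) N) (m<n⇒m%n≡m (toℕ<n x))))

  ⊕-inverse : ∀ x a b → a + b ≡ N → x ⊕ a ⊕ b ≡ x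
  ⊕-inverse x a b a+b≡N = ≡.trans (⊕-+ x a b) (≡.trans (cong (x ⊕_) a+b≡N) (⊕-N x))

  zero⊕ : ∀ i → zero ⊕ toℕ i ≡ i
  zero⊕ i = toℕ-injective (≡.trans (toℕ-⊕ zero (toℕ i)) (m<n⇒m%n≡m (toℕ<n i)))

  ⊕-complement : ∀ x → x ⊕ (N ∸ toℕ x) ≡ zero
  ⊕-complement x = toℕ-injective (≡.trans (toℕ-⊕ x (N ∸ toℕ x))
    (≡.trans (cong (_% N) (m+[n∸m]≡n (<⇒≤ (toℕ<n x)))) (n%n≡0 N)))

  complement+ : ∀ i → N ∸ toℕ i + toℕ i ≡ N
  complement+ i = m∸n+n≡m (<⇒≤ (toℕ<n i))

  shift : Fin N → Permutation′ N
  shift i = permutation (_⊕ toℕ i) (_⊕ (N ∸ toℕ i))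
    (λ y → ⊕-inverse y (N ∸ toℕ i) (toℕ i) (complement+ i))
    (λ x → ⊕-inverse x (toℕ i) (N ∸ toℕ i) (m+[n∸m]≡n (<⇒≤ (toℕ<n i))))

  shifts : List (Permutation′ N)
  shifts = map shift (allFin N)

  _Shifts-by_ : Permutation′ N → ℕ → Set
  g Shifts-by a = ∀ x → g ⟨$⟩ʳ x ≡ x ⊕ a

  ∈-shifts⁺ : ∀ {g} a → g Shifts-by a → g ∈ shifts
  ∈-shifts⁺ a g-shifts = Any.map⁺ (Any.map (λ { ≡.refl x → ≡.trans (g-shifts x)
    (≡.trans (≡.sym (⊕-% x a)) (cong (x ⊕_) (≡.sym (toℕ-fromℕ< _)))) }) (∈-allFin (a mod N)))

  ∈-shifts⁻ : ∀ {g} → g ∈ shifts → ∃ λ i → g Shifts-by toℕ i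
  ∈-shifts⁻ g∈shifts = Any.satisfied (Any.map⁻ g∈shifts)

  ∘ₚ-shifts : ∀ {g h a b} → g Shifts-by a → h Shifts-by b → (g ∘ₚ h) Shifts-by (a + b)
  ∘ₚ-shifts {g} {h} {a} {b} g-shifts h-shifts x =
    ≡.trans (h-shifts (g ⟨$⟩ʳ x)) (≡.trans (cong (_⊕ b) (g-shifts x)) (⊕-+ x a b))

  flip-shifts : ∀ {g} i → g Shifts-by toℕ i → flip g Shifts-by (N ∸ toℕ i)
  flip-shifts {g} i g-shifts x = ≡.trans
    (cong (g ⟨$⟩ˡ_) (≡.sym (≡.trans (g-shifts _) (⊕-inverse x (N ∸ toℕ i) (toℕ i) (complement+ i)))))
    (inverseˡ g)

  cyclic : PermGroup N
  cyclic = record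
    { elems    = shifts
    ; distinct = AllPairs.map⁺ (AllPairs.map (λ {i} {j} i≢j shiftᵢ≈shiftⱼ →
                   i≢j (≡.trans (≡.sym (zero⊕ i)) (≡.trans (shiftᵢ≈shiftⱼ zero) (zero⊕ j)))) (allFin⁺ N))
    ; hasId    = ∈-shifts⁺ {id} N (λ x → ≡.sym (⊕-N x))
    ; closed∘  = λ g h g∈ h∈ →
        let (i , g-shifts) = ∈-shifts⁻ {g} g∈ ; (j , h-shifts) = ∈-shifts⁻ {h} h∈
        in ∈-shifts⁺ {g ∘ₚ h} (toℕ i + toℕ j) (∘ₚ-shifts {g} {h} g-shifts h-shifts)
    ; closed⁻¹ = λ g g∈ →
        let (i , g-shifts) = ∈-shifts⁻ {g} g∈ in ∈-shifts⁺ {flip g} (N ∸ toℕ i) (flip-shifts {g} i g-shifts)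
    }

  cyclic-transitive : Transitive cyclic
  cyclic-transitive α β = shift i , Any.map⁺ (Any.map (λ { ≡.refl _ → ≡.refl }) (∈-allFin i)) , (begin
    α ⊕ toℕ i               ≡⟨ cong (α ⊕_) (toℕ-fromℕ< _) ⟩
    α ⊕ c % N               ≡⟨ ⊕-% α c ⟩
    α ⊕ (N ∸ toℕ α + toℕ β) ≡⟨ ⊕-+ α (N ∸ toℕ α) (toℕ β) ⟨
    α ⊕ (N ∸ toℕ α) ⊕ toℕ β ≡⟨ cong (_⊕ toℕ β) (⊕-complement α) ⟩
    zero ⊕ toℕ β            ≡⟨ zero⊕ β ⟩
    β                       ∎)
    where
    open ≡.≡-Reasoning
    c : ℕ
    c = N ∸ toℕ α + toℕ β
    i : Fin N
    i = c mod N

ratio-self : ∀ m .{{_ : NonZero m}} → ratio m m ≡ 1ℚ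
ratio-self (suc b) = fromℚᵘ-cong {ℚᵘ.mkℚᵘ (ℤ.+ suc b) b} {ℚᵘ.1ℚᵘ}
  (ℚᵘ.*≡* (≡.trans (ℤ.*-identityʳ (ℤ.+ suc b)) (≡.sym (ℤ.*-identityˡ (ℤ.+ suc b)))))

ratio-≤-1 : ∀ {a m} .{{_ : NonZero m}} → a ≤ m → ratio a m ≤ℚ 1ℚ
ratio-≤-1 {a} {suc b} a≤m = toℚᵘ-cancel-≤ (ℚᵘ.≤-respˡ-≃ (ℚᵘ.≃-sym (toℚᵘ-fromℚᵘ (ℚᵘ.mkℚᵘ (ℤ.+ a) b)))
  (ℚᵘ.*≤* (≡.subst₂ ℤ._≤_ (≡.sym (ℤ.*-identityʳ (ℤ.+ a))) (≡.sym (ℤ.*-identityˡ (ℤ.+ suc b)))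
    (ℤ.+≤+ a≤m))))

density-unique : ∀ {n} {G : PermGroup n} {r s} → IsIntersectionDensity G r → IsIntersectionDensity G s → r ≡ s
density-unique ((F , F-intersecting , r≡) , r-max) ((F′ , F′-intersecting , s≡) , s-max) =
  ≤ℚ-antisym (subst (_≤ℚ _) (≡.sym r≡) (s-max F F-intersecting))
             (subst (_≤ℚ _) (≡.sym s≡) (r-max F′ F′-intersecting))

density-one : ∀ {n} (G : PermGroup n) ω → maxStab G ≡ stabSize G ω →
              (∀ F → IsIntersectingSubset G F → length F ≤ stabSize G ω) → IsIntersectionDensity G 1ℚ
density-one G ω max≡stab F≤stab =
  (stabilizer G ω , stabilizer-intersecting G ω ,
    ≡.sym (≡.trans (cong (ratio _) max≡stab) (ratio-self (stabSize G ω)))) ,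
  λ F F-intersecting →
    subst (λ m → ratio (length F) m ≤ℚ 1ℚ) (≡.sym max≡stab) (ratio-≤-1 (F≤stab F F-intersecting))
  where instance _ = >-nonZero (0<stabSize G ω)

module _ {p} (p-prime : Prime p) where
  private instance _ = prime⇒nonZero p-prime

  prime-degree-EKR : (G : PermGroup p) → Transitive G →
                     ∀ {F} → IsIntersectingSubset G F → ∀ ω → length F ≤ stabSize G ω
  prime-degree-EKR G transitive {F} F-intersecting ω
    with c , c∈G , cᵖ≈id , c≉id ← Cauchy.cauchy G p-prime (OrbitStabilizer.degree∣order G transitive ω) =
    intersecting-≤-stabSize G transitive {F} (λ i → c ^ₚ toℕ i) F-intersecting
      (λ i → ^ₚ-∈ G c∈G (toℕ i)) (powers-nonIntersecting p-prime cᵖ≈id c≉id) ω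

  prime-degree-density : (G : PermGroup p) → Transitive G → IsIntersectionDensity G 1ℚ
  prime-degree-density G transitive = density-one G ω (maxStab≡stabSize G transitive ω)
    (λ F F-intersecting → prime-degree-EKR G transitive F-intersecting ω)
    where
    ω : Fin p
    ω = fromℕ< (>-nonZero⁻¹ p)

lemma2p2 : (n : ℕ) → Prime n →
    ((G : PermGroup n) → Transitive G → IsIntersectionDensity G 1ℚ)
    × ((r : ℚ) → (InI n r → r ≡ 1ℚ) × (r ≡ 1ℚ → InI n r))
lemma2p2 zero    0-prime = ⊥-elim (¬prime[0] 0-prime)
lemma2p2 (suc k) n-prime = prime-degree-density n-prime , λ r →
  (λ (G , transitive , ρ≡r) → density-unique {G = G} ρ≡r (prime-degree-density n-prime G transitive)) ,
  λ { ≡.refl → cyclic , cyclic-transitive , prime-degree-density n-prime cyclic cyclic-transitive }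
  where open CyclicGroup k
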